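{- Let $(\Omega,S)$ be a regular thin Jordan scheme, fix $\omega_0\in\Omega$ and let $\diamond$ be as in the context. Then for all $u,v\in S$, $(v\diamond u)^t=u^t\diamond v^t$.
   Context: $\Omega$ is a finite nonempty set, $\mathbb{F}$ a field with $\mathrm{char}\,\mathbb{F}\neq2$, $A\star B=\tfrac12(AB+BA)$. A regular thin Jordan scheme $(\Omega,S)$ here means: $S$ is a set of permutations of $\Omega$, each regarded as the relation $\{(\omega,s(\omega))\}$, such that these relations partition $\Omega\times\Omega$, $1_\Omega\in S$, $s^{ -1}\in S$ for every $s\in S$, and the $\mathbb{F}$-span of the permutation matrices of the elements of $S$ is closed under $\star$. For $s\in S$, $s^t=s^{ -1}$ (the transposed relation). For fixed $\omega_0\in\Omega$ and $a,b\in S$, $a\diamond b$ is the unique $c\in S$ with $c(\omega_0)=a(b(\omega_0))$. -}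

module Defs where

open import Level using (Level; _⊔_) renaming (suc to lsuc)
open import Data.Nat using (ℕ; zero; suc)
open import Data.Fin using (Fin; zero; suc; _≟_)
open import Data.Fin.Permutation using (Permutation′; _⟨$⟩ʳ_; _⟨$⟩ˡ_)
open import Data.Product using (Σ; ∃; ∃!; _×_; _,_; proj₁)
open import Relation.Nullary using (¬_; yes; no)
open import Relation.Binary.PropositionalEquality using (_≡_)
open import Algebra.Bundles using (CommutativeRing)

record Field (c ℓ : Level) : Set (lsuc (c ⊔ ℓ)) where
  field
    commutativeRing : CommutativeRing c ℓ
  open CommutativeRing commutativeRing public
  field
    0≉1     : ¬ (0# ≈ 1#)
    inverse : ∀ x → ¬ (x ≈ 0#) → Σ Carrier (λ y → x * y ≈ 1#)

module FieldMatrices {c ℓ : Level} (F : Field c ℓ) where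
  open Field F using (Carrier; _≈_; _+_; _*_; 0#; 1#; inverse)

  CharNot2 : Set ℓ
  CharNot2 = ¬ ((1# + 1#) ≈ 0#)

  half : CharNot2 → Carrier
  half ch = proj₁ (inverse (1# + 1#) ch)

  ∑ : ∀ {k} → (Fin k → Carrier) → Carrier
  ∑ {zero}  f = 0#
  ∑ {suc k} f = f zero + ∑ (λ i → f (suc i))

  Mat : ℕ → Set c
  Mat n = Fin n → Fin n → Carrier

  _⊕_ : ∀ {n} → Mat n → Mat n → Mat n
  (A ⊕ B) i j = A i j + B i j

  _⊗_ : ∀ {n} → Mat n → Mat n → Mat n
  (A ⊗ B) i j = ∑ (λ k → A i k * B k j)

  jordan : ∀ {n} → CharNot2 → Mat n → Mat n → Mat n
  jordan ch A B i j = half ch * ((A ⊗ B) ⊕ (B ⊗ A)) i j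

  -- adjacency (permutation) matrix of the relation {(ω, s ω)}
  permMat : ∀ {n} → Permutation′ n → Mat n
  permMat s i j with j ≟ (s ⟨$⟩ʳ i)
  ... | yes _ = 1#
  ... | no  _ = 0#

  lincomb : ∀ {n m} → (Fin m → Permutation′ n) → (Fin m → Carrier) → Mat n
  lincomb s coef i j = ∑ (λ k → coef k * permMat (s k) i j)

-- S is given as an indexed family s : Fin m → Permutation′ n; the partition
-- condition (each pair is in exactly one relation) makes the family injective.
record RegularThinJordanScheme {c ℓ : Level} (F : Field c ℓ)
         (ch : FieldMatrices.CharNot2 F) (n : ℕ) : Set (c ⊔ ℓ) where
  open Field F using (Carrier; _≈_)
  open FieldMatrices F
  field
    m : ℕ
    s : Fin m → Permutation′ n
    partition : ∀ ω ω′ → ∃! _≡_ (λ (i : Fin m) → s i ⟨$⟩ʳ ω ≡ ω′)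
    identity  : Σ (Fin m) (λ i → ∀ ω → s i ⟨$⟩ʳ ω ≡ ω)
    inverses  : ∀ i → Σ (Fin m) (λ j → ∀ ω → s j ⟨$⟩ʳ ω ≡ s i ⟨$⟩ˡ ω)
    jordanClosed : ∀ (a b : Fin m → Carrier) →
      Σ (Fin m → Carrier) (λ e → ∀ i j →
        jordan ch (lincomb s a) (lincomb s b) i j ≈ lincomb s e i j)

  -- a' is (the index of) the transpose a^t = a⁻¹ of a
  IsTranspose : Fin m → Fin m → Set
  IsTranspose a a′ = ∀ ω → s a′ ⟨$⟩ʳ ω ≡ s a ⟨$⟩ˡ ω

  -- c = a ⋄ b  (w.r.t. the base point ω₀):  c(ω₀) = a(b(ω₀))
  IsDiamond : Fin n → Fin m → Fin m → Fin m → Set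
  IsDiamond ω₀ a b c = s c ⟨$⟩ʳ ω₀ ≡ s a ⟨$⟩ʳ (s b ⟨$⟩ʳ ω₀)

-- Since ½(P_a P_b + P_b P_a) lies in the span of the permutation matrices P_k,
-- its (i, k(i)) entry is the coefficient of P_k, independent of i; as char ≠ 2
-- separates 0, ½ and 1, the number of the two compositions b ∘ a, a ∘ b that
-- send i to k(i) is independent of i. Combining this for the three pairs drawn
-- from wᵗ, u, v shows that [i = v u wᵗ i] + [i = wᵗ u v i] is independent of i.
-- It is positive at i = w ω₀, and either term being positive at ω₀ forces
-- wᵗ ω₀ = uᵗ vᵗ ω₀.
module Submission where

open import Defs
open import Level using (Level)
open import Data.Nat as Nat using (ℕ; zero; suc; _≤_; z≤n; s≤s)
open import Data.Nat.Properties using (+-mono-≤; +-cancelʳ-≡)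
open import Data.Nat.Tactic.RingSolver using (solve-∀)
open import Data.Fin using (Fin; zero; suc; _≟_)
open import Data.Fin.Properties using (suc-injective)
open import Data.Fin.Permutation using (Permutation′; _⟨$⟩ʳ_; _⟨$⟩ˡ_; inverseˡ; inverseʳ)
open import Data.Product using (_,_; proj₁; proj₂; _×_)
open import Data.Sum using (_⊎_; inj₁; inj₂)
open import Data.Empty using (⊥-elim)
open import Relation.Nullary using (¬_; Dec; yes; no)
open import Relation.Binary.PropositionalEquality
  using (_≡_; _≢_; refl; sym; trans; cong; cong₂; module ≡-Reasoning)
import Algebra.Properties.Group as GroupProperties

⟦_⟧ : ∀ {p} {A : Set p} → Dec A → ℕ
⟦ yes _ ⟧ = 1
⟦ no _ ⟧ = 0

⟦⟧≤1 : ∀ {p} {A : Set p} (d : Dec A) → ⟦ d ⟧ ≤ 1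
⟦⟧≤1 (yes _) = s≤s z≤n
⟦⟧≤1 (no _) = z≤n

⟦⟧-yes : ∀ {p} {A : Set p} (d : Dec A) → A → ⟦ d ⟧ ≡ 1
⟦⟧-yes (yes _) _ = refl
⟦⟧-yes (no ¬a) a = ⊥-elim (¬a a)

⟦⟧-cong : ∀ {p q} {A : Set p} {B : Set q} → (A → B) → (B → A) →
  (d : Dec A) (e : Dec B) → ⟦ d ⟧ ≡ ⟦ e ⟧
⟦⟧-cong _ _ (yes _) (yes _) = refl
⟦⟧-cong f _ (yes a) (no ¬b) = ⊥-elim (¬b (f a))
⟦⟧-cong _ g (no ¬a) (yes b) = ⊥-elim (¬a (g b))
⟦⟧-cong _ _ (no _) (no _) = refl

module FieldLemmas {c ℓ : Level} (F : Field c ℓ) where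
  open Field F hiding (zero) renaming (refl to ≈-refl; sym to ≈-sym; trans to ≈-trans)
  open FieldMatrices F
  open GroupProperties +-group using (identityˡ-unique)
  open import Relation.Binary.Reasoning.Setoid setoid

  ∑-cong : ∀ {k} {f g : Fin k → Carrier} → (∀ x → f x ≈ g x) → ∑ f ≈ ∑ g
  ∑-cong {zero} _ = ≈-refl
  ∑-cong {suc k} h = +-cong (h zero) (∑-cong (λ x → h (suc x)))

  ∑-zero : ∀ {k} (f : Fin k → Carrier) → (∀ x → f x ≈ 0#) → ∑ f ≈ 0#
  ∑-zero {zero} _ _ = ≈-refl
  ∑-zero {suc k} f h = ≈-trans (+-cong (h zero) (∑-zero _ (λ x → h (suc x)))) (+-identityˡ 0#)

  ∑-single : ∀ {k} (f : Fin k → Carrier) (a : Fin k) → (∀ x → x ≢ a → f x ≈ 0#) → ∑ f ≈ f a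
  ∑-single f zero h =
    ≈-trans (+-congˡ (∑-zero _ (λ x → h (suc x) (λ ())))) (+-identityʳ (f zero))
  ∑-single f (suc a) h =
    ≈-trans (+-congʳ (h zero (λ ())))
          (≈-trans (+-identityˡ _) (∑-single _ a (λ x x≢a → h (suc x) (λ eq → x≢a (suc-injective eq)))))

  ι : ∀ {p} {A : Set p} → Dec A → Carrier
  ι (yes _) = 1#
  ι (no _) = 0#

  ι-yes : ∀ {p} {A : Set p} (d : Dec A) → A → ι d ≈ 1#
  ι-yes (yes _) _ = ≈-refl
  ι-yes (no ¬a) a = ⊥-elim (¬a a)

  ι-no : ∀ {p} {A : Set p} (d : Dec A) → ¬ A → ι d ≈ 0#
  ι-no (yes a) ¬a = ⊥-elim (¬a a)
  ι-no (no _) _ = ≈-refl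

  permMat-ι : ∀ {n} (π : Permutation′ n) i j → permMat π i j ≈ ι (j ≟ π ⟨$⟩ʳ i)
  permMat-ι π i j with j ≟ π ⟨$⟩ʳ i
  ... | yes _ = ≈-refl
  ... | no _ = ≈-refl

  permMat-≢ : ∀ {n} (π : Permutation′ n) {i j} → j ≢ π ⟨$⟩ʳ i → permMat π i j ≈ 0#
  permMat-≢ π {i} {j} j≢ = ≈-trans (permMat-ι π i j) (ι-no (j ≟ π ⟨$⟩ʳ i) j≢)

  permMat-diag : ∀ {n} (π : Permutation′ n) i → permMat π i (π ⟨$⟩ʳ i) ≈ 1#
  permMat-diag π i = ≈-trans (permMat-ι π i (π ⟨$⟩ʳ i)) (ι-yes (π ⟨$⟩ʳ i ≟ π ⟨$⟩ʳ i) refl)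

  ⊗-cong : ∀ {n} {A A′ B B′ : Mat n} → (∀ i j → A i j ≈ A′ i j) → (∀ i j → B i j ≈ B′ i j) →
    ∀ i j → (A ⊗ B) i j ≈ (A′ ⊗ B′) i j
  ⊗-cong A≈ B≈ i j = ∑-cong (λ k → *-cong (A≈ i k) (B≈ k j))

  permMat-⊗ : ∀ {n} (p q : Permutation′ n) i j →
    (permMat p ⊗ permMat q) i j ≈ ι (j ≟ q ⟨$⟩ʳ (p ⟨$⟩ʳ i))
  permMat-⊗ p q i j = begin
    ∑ (λ k → permMat p i k * permMat q k j)
      ≈⟨ ∑-single _ (p ⟨$⟩ʳ i) (λ k k≢ → ≈-trans (*-congʳ (permMat-≢ p k≢)) (zeroˡ _)) ⟩
    permMat p i (p ⟨$⟩ʳ i) * permMat q (p ⟨$⟩ʳ i) j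
      ≈⟨ ≈-trans (*-congʳ (permMat-diag p i)) (*-identityˡ _) ⟩
    permMat q (p ⟨$⟩ʳ i) j
      ≈⟨ permMat-ι q _ j ⟩
    ι (j ≟ q ⟨$⟩ʳ (p ⟨$⟩ʳ i)) ∎

  basis : ∀ {m} → Fin m → Fin m → Carrier
  basis a k = ι (k ≟ a)

  lincomb-basis : ∀ {n m} (s : Fin m → Permutation′ n) a i j →
    lincomb s (basis a) i j ≈ permMat (s a) i j
  lincomb-basis s a i j =
    ≈-trans (∑-single _ a (λ x x≢a → ≈-trans (*-congʳ (ι-no (x ≟ a) x≢a)) (zeroˡ _)))
          (≈-trans (*-congʳ (ι-yes (a ≟ a) refl)) (*-identityˡ _))

  lincomb-coeff : ∀ {n m} (s : Fin m → Permutation′ n) (e : Fin m → Carrier) k i →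
    (∀ x → s x ⟨$⟩ʳ i ≡ s k ⟨$⟩ʳ i → x ≡ k) →
    lincomb s e i (s k ⟨$⟩ʳ i) ≈ e k
  lincomb-coeff s e k i injective =
    ≈-trans (∑-single _ k (λ x x≢k →
             ≈-trans (*-congˡ (permMat-≢ (s x) (λ eq → x≢k (injective x (sym eq))))) (zeroʳ _)))
          (≈-trans (*-congˡ (permMat-diag (s k) i)) (*-identityʳ _))

  -- Counts above 2 never occur; they are sent to 2 as a junk value.
  fromCount : ℕ → Carrier
  fromCount zero = 0#
  fromCount (suc zero) = 1#
  fromCount (suc (suc _)) = 1# + 1#

  ι+ι≈fromCount : ∀ {p q} {A : Set p} {B : Set q} (d : Dec A) (e : Dec B) →
    ι d + ι e ≈ fromCount (⟦ d ⟧ Nat.+ ⟦ e ⟧)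
  ι+ι≈fromCount (yes _) (yes _) = ≈-refl
  ι+ι≈fromCount (yes _) (no _) = +-identityʳ _
  ι+ι≈fromCount (no _) (yes _) = +-identityˡ _
  ι+ι≈fromCount (no _) (no _) = +-identityˡ _

  1≉1+1 : ¬ (1# ≈ 1# + 1#)
  1≉1+1 eq = 0≉1 (≈-sym (identityˡ-unique 1# 1# (≈-sym eq)))

  cancel-invertibleˡ : ∀ {t u x y} → u * t ≈ 1# → t * x ≈ t * y → x ≈ y
  cancel-invertibleˡ {t} {u} {x} {y} ut≈1 tx≈ty = begin
    x             ≈⟨ ≈-sym (*-identityˡ x) ⟩
    1# * x        ≈⟨ *-congʳ (≈-sym ut≈1) ⟩
    (u * t) * x   ≈⟨ *-assoc u t x ⟩
    u * (t * x)   ≈⟨ *-congˡ tx≈ty ⟩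
    u * (t * y)   ≈⟨ ≈-sym (*-assoc u t y) ⟩
    (u * t) * y   ≈⟨ *-congʳ ut≈1 ⟩
    1# * y        ≈⟨ *-identityˡ y ⟩
    y             ∎

  module _ (ch : CharNot2) where

    fromCount-injective : ∀ {a b} → a ≤ 2 → b ≤ 2 → fromCount a ≈ fromCount b → a ≡ b
    fromCount-injective {0} {0} _ _ _ = refl
    fromCount-injective {0} {1} _ _ eq = ⊥-elim (0≉1 eq)
    fromCount-injective {0} {2} _ _ eq = ⊥-elim (ch (≈-sym eq))
    fromCount-injective {1} {0} _ _ eq = ⊥-elim (0≉1 (≈-sym eq))
    fromCount-injective {1} {1} _ _ _ = refl
    fromCount-injective {1} {2} _ _ eq = ⊥-elim (1≉1+1 eq)
    fromCount-injective {2} {0} _ _ eq = ⊥-elim (ch eq)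
    fromCount-injective {2} {1} _ _ eq = ⊥-elim (1≉1+1 (≈-sym eq))
    fromCount-injective {2} {2} _ _ _ = refl
    fromCount-injective {suc (suc (suc _))} (s≤s (s≤s ()))
    fromCount-injective {b = suc (suc (suc _))} _ (s≤s (s≤s ()))

    half-cancel : ∀ {x y} → half ch * x ≈ half ch * y → x ≈ y
    half-cancel = cancel-invertibleˡ (proj₂ (inverse (1# + 1#) ch))

    jordan-basis : ∀ {n m} (s : Fin m → Permutation′ n) a b i j →
      jordan ch (lincomb s (basis a)) (lincomb s (basis b)) i j
        ≈ half ch * fromCount (⟦ j ≟ s b ⟨$⟩ʳ (s a ⟨$⟩ʳ i) ⟧ Nat.+ ⟦ j ≟ s a ⟨$⟩ʳ (s b ⟨$⟩ʳ i) ⟧)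
    jordan-basis s a b i j = *-congˡ (begin
      (A ⊗ B) i j + (B ⊗ A) i j
        ≈⟨ +-cong (⊗-cong (lincomb-basis s a) (lincomb-basis s b) i j)
                  (⊗-cong (lincomb-basis s b) (lincomb-basis s a) i j) ⟩
      (permMat (s a) ⊗ permMat (s b)) i j + (permMat (s b) ⊗ permMat (s a)) i j
        ≈⟨ +-cong (permMat-⊗ (s a) (s b) i j) (permMat-⊗ (s b) (s a) i j) ⟩
      ι (j ≟ s b ⟨$⟩ʳ (s a ⟨$⟩ʳ i)) + ι (j ≟ s a ⟨$⟩ʳ (s b ⟨$⟩ʳ i))
        ≈⟨ ι+ι≈fromCount (j ≟ s b ⟨$⟩ʳ (s a ⟨$⟩ʳ i)) (j ≟ s a ⟨$⟩ʳ (s b ⟨$⟩ʳ i)) ⟩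
      fromCount (⟦ j ≟ s b ⟨$⟩ʳ (s a ⟨$⟩ʳ i) ⟧ Nat.+ ⟦ j ≟ s a ⟨$⟩ʳ (s b ⟨$⟩ʳ i) ⟧) ∎)
      where
      A = lincomb s (basis a)
      B = lincomb s (basis b)

open Nat using (_+_)

⟦⟧+⟦⟧≡suc⇒⊎ : ∀ {p q k} {A : Set p} {B : Set q} (d : Dec A) (e : Dec B) →
  ⟦ d ⟧ + ⟦ e ⟧ ≡ suc k → A ⊎ B
⟦⟧+⟦⟧≡suc⇒⊎ (yes a) _ _ = inj₁ a
⟦⟧+⟦⟧≡suc⇒⊎ (no _) (yes b) _ = inj₂ b

⟦⟧+⟦⟧≡2⇒× : ∀ {p q} {A : Set p} {B : Set q} (d : Dec A) (e : Dec B) →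
  ⟦ d ⟧ + ⟦ e ⟧ ≡ 2 → A × B
⟦⟧+⟦⟧≡2⇒× (yes a) (yes b) _ = a , b
⟦⟧+⟦⟧≡2⇒× (yes _) (no _) ()
⟦⟧+⟦⟧≡2⇒× (no _) (yes _) ()
⟦⟧+⟦⟧≡2⇒× (no _) (no _) ()

module Scheme {c ℓ : Level} (F : Field c ℓ) (ch : FieldMatrices.CharNot2 F)
    (n : ℕ) (X : RegularThinJordanScheme F ch n) where
  open Field F using (_≈_; _*_) renaming (sym to ≈-sym; trans to ≈-trans)
  open FieldMatrices F
  open FieldLemmas F
  open RegularThinJordanScheme X
  open ≡-Reasoning

  infixr 5 _·_
  _·_ : Fin m → Fin n → Fin n
  a · i = s a ⟨$⟩ʳ i

  ·-injectiveˡ : ∀ {a b} ω → a · ω ≡ b · ω → a ≡ b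
  ·-injectiveˡ {b = b} ω eq with partition ω (b · ω)
  ... | _ , _ , unique = trans (sym (unique eq)) (unique refl)

  module _ {a at : Fin m} (h : IsTranspose a at) where

    transpose-cancelˡ : ∀ i → at · a · i ≡ i
    transpose-cancelˡ i = trans (h (a · i)) (inverseˡ (s a))

    transpose-cancelʳ : ∀ i → a · at · i ≡ i
    transpose-cancelʳ i = trans (cong (a ·_) (h i)) (inverseʳ (s a))

    transpose-move : ∀ {x y} → a · x ≡ y → x ≡ at · y
    transpose-move {x} eq = trans (sym (transpose-cancelˡ x)) (cong (at ·_) eq)

    IsTranspose-sym : IsTranspose at a
    IsTranspose-sym i = trans (sym (inverseˡ (s at))) (cong (s at ⟨$⟩ˡ_) (transpose-cancelˡ i))

    ⟦⟧-transpose : ∀ i j → ⟦ at · i ≟ j ⟧ ≡ ⟦ i ≟ a · j ⟧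
    ⟦⟧-transpose i j = ⟦⟧-cong
      (λ eq → trans (sym (transpose-cancelʳ i)) (cong (a ·_) eq))
      (λ eq → sym (transpose-move (sym eq)))
      (at · i ≟ j) (i ≟ a · j)

  -- The (i, j) entry of P_a P_b + P_b P_a.
  jordanCount : Fin m → Fin m → Fin n → Fin n → ℕ
  jordanCount a b i j = ⟦ j ≟ b · a · i ⟧ + ⟦ j ≟ a · b · i ⟧

  jordanCount≤2 : ∀ a b i j → jordanCount a b i j ≤ 2
  jordanCount≤2 a b i j = +-mono-≤ (⟦⟧≤1 (j ≟ b · a · i)) (⟦⟧≤1 (j ≟ a · b · i))

  jordanCount-invariant : ∀ a b k i i′ → jordanCount a b i (k · i) ≡ jordanCount a b i′ (k · i′)
  jordanCount-invariant a b k i i′ =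
    fromCount-injective ch (jordanCount≤2 a b i (k · i)) (jordanCount≤2 a b i′ (k · i′))
      (half-cancel ch (≈-trans (entry i) (≈-sym (entry i′))))
    where
    e = proj₁ (jordanClosed (basis a) (basis b))
    entry : ∀ i → half ch * fromCount (jordanCount a b i (k · i)) ≈ e k
    entry i = ≈-trans (≈-sym (jordan-basis ch s a b i (k · i)))
      (≈-trans (proj₂ (jordanClosed (basis a) (basis b)) i (k · i))
               (lincomb-coeff s e k i (λ _ → ·-injectiveˡ i)))

  commutes-everywhere : ∀ {a b k i} → k · i ≡ b · a · i → k · i ≡ a · b · i →
    ∀ i′ → (k · i′ ≡ b · a · i′) × (k · i′ ≡ a · b · i′)
  commutes-everywhere {a} {b} {k} {i} eq₁ eq₂ i′ =
    ⟦⟧+⟦⟧≡2⇒× (k · i′ ≟ b · a · i′) (k · i′ ≟ a · b · i′)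
      (trans (sym (jordanCount-invariant a b k i i′))
             (cong₂ _+_ (⟦⟧-yes (k · i ≟ b · a · i) eq₁) (⟦⟧-yes (k · i ≟ a · b · i) eq₂)))

  cyclicCount : Fin m → Fin m → Fin m → Fin n → ℕ
  cyclicCount a b c i = ⟦ i ≟ c · b · a · i ⟧ + ⟦ i ≟ a · b · c · i ⟧

  module _ {a b c at bt ct : Fin m}
      (ha : IsTranspose a at) (hb : IsTranspose b bt) (hc : IsTranspose c ct) where

    private
      rest : Fin n → ℕ
      rest i = jordanCount a c (b · i) i

      rest-invariant : ∀ i i′ → rest i ≡ rest i′
      rest-invariant i i′ = begin
        jordanCount a c (b · i) i              ≡⟨ cong (jordanCount a c (b · i)) (sym (transpose-cancelˡ hb i)) ⟩
        jordanCount a c (b · i) (bt · b · i)   ≡⟨ jordanCount-invariant a c bt (b · i) (b · i′) ⟩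
        jordanCount a c (b · i′) (bt · b · i′) ≡⟨ cong (jordanCount a c (b · i′)) (transpose-cancelˡ hb i′) ⟩
        jordanCount a c (b · i′) i′            ∎

      -- rest i = [i = c a b i] + [i = a c b i]; moving ct and at across turns the right-hand side
      -- into the same four fixed-point indicators.
      cyclicCount+rest : ∀ i → cyclicCount a b c i + rest i ≡ jordanCount a b i (ct · i) + jordanCount b c i (at · i)
      cyclicCount+rest i = trans
        (regroup ⟦ i ≟ c · b · a · i ⟧ ⟦ i ≟ a · b · c · i ⟧ ⟦ i ≟ c · a · b · i ⟧ ⟦ i ≟ a · c · b · i ⟧)
        (sym (cong₂ _+_
          (cong₂ _+_ (⟦⟧-transpose hc i (b · a · i)) (⟦⟧-transpose hc i (a · b · i)))
          (cong₂ _+_ (⟦⟧-transpose ha i (c · b · i)) (⟦⟧-transpose ha i (b · c · i)))))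
        where
        regroup : ∀ p q r t → p + q + (r + t) ≡ (p + r) + (t + q)
        regroup = solve-∀

    cyclicCount-invariant : ∀ i i′ → cyclicCount a b c i ≡ cyclicCount a b c i′
    cyclicCount-invariant i i′ = +-cancelʳ-≡ (rest i) _ _ (begin
      cyclicCount a b c i + rest i                          ≡⟨ cyclicCount+rest i ⟩
      jordanCount a b i (ct · i) + jordanCount b c i (at · i)
        ≡⟨ cong₂ _+_ (jordanCount-invariant a b ct i i′) (jordanCount-invariant b c at i i′) ⟩
      jordanCount a b i′ (ct · i′) + jordanCount b c i′ (at · i′) ≡⟨ sym (cyclicCount+rest i′) ⟩
      cyclicCount a b c i′ + rest i′                        ≡⟨ cong (cyclicCount a b c i′ +_) (rest-invariant i′ i) ⟩
      cyclicCount a b c i′ + rest i                         ∎)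

  diamond-transpose : ∀ ω₀ {u v w wt ut vt} → IsDiamond ω₀ v u w →
    IsTranspose w wt → IsTranspose u ut → IsTranspose v vt → wt · ω₀ ≡ ut · vt · ω₀
  diamond-transpose ω₀ {u} {v} {w} {wt} {ut} {vt} hd hw hu hv
    with ⟦⟧+⟦⟧≡suc⇒⊎ (ω₀ ≟ v · u · wt · ω₀) (ω₀ ≟ wt · u · v · ω₀) cyclic-positive
    where
    cyclic-positive : cyclicCount wt u v ω₀ ≡ suc ⟦ w · ω₀ ≟ wt · u · v · w · ω₀ ⟧
    cyclic-positive = trans (cyclicCount-invariant (IsTranspose-sym hw) hu hv ω₀ (w · ω₀))
      (cong (_+ ⟦ w · ω₀ ≟ wt · u · v · w · ω₀ ⟧) (⟦⟧-yes (w · ω₀ ≟ v · u · wt · w · ω₀)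
        (trans hd (cong (λ i → v · u · i) (sym (transpose-cancelˡ hw ω₀))))))
  ... | inj₁ fixed = transpose-move hu (transpose-move hv (sym fixed))
  ... | inj₂ fixed = sym (transpose-move hw (begin
    w · ut · vt · ω₀     ≡⟨ proj₁ (commutes-everywhere hd w≡uv (ut · vt · ω₀)) ⟩
    v · u · ut · vt · ω₀ ≡⟨ cong (v ·_) (transpose-cancelʳ hu (vt · ω₀)) ⟩
    v · vt · ω₀          ≡⟨ transpose-cancelʳ hv ω₀ ⟩
    ω₀                   ∎))
    where
    w≡uv : w · ω₀ ≡ u · v · ω₀
    w≡uv = sym (transpose-move (IsTranspose-sym hw) (sym fixed))

proposition3p11 : ∀ {c ℓ : Level} (F : Field c ℓ) (ch : FieldMatrices.CharNot2 F)
    (n : ℕ) (X : RegularThinJordanScheme F ch n) (ω₀ : Fin n) →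
    let open RegularThinJordanScheme X in
    ∀ (u v w wt ut vt z : Fin m) →
    IsDiamond ω₀ v u w → IsTranspose w wt →
    IsTranspose u ut → IsTranspose v vt → IsDiamond ω₀ ut vt z →
    wt ≡ z
proposition3p11 F ch n X ω₀ u v w wt ut vt z hd hw hu hv hz =
  ·-injectiveˡ ω₀ (trans (diamond-transpose ω₀ hd hw hu hv) (sym hz))
  where open Scheme F ch n X
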